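{- Let $G$ be a finite connected simple graph on $[d]$ and let $\mathcal{H}:\sum_i a_ix_i=0$ and $\mathcal{H}':\sum_i a'_ix_i=0$ be type I separating hyperplanes of the edge polytope $\mathcal{P}_G$ which give the same decomposition, i.e. $\{\mathcal{P}_G\cap\mathcal{H}^{(+)},\mathcal{P}_G\cap\mathcal{H}^{(-)}\}=\{\mathcal{P}_G\cap\mathcal{H}'^{(+)},\mathcal{P}_G\cap\mathcal{H}'^{(-)}\}$. Then $(a'_1,\dots,a'_d)=\pm(a_1,\dots,a_d)$.
   Context: For an edge $e=(i,j)$, $\rho(e)=\mathbf{e}_i+\mathbf{e}_j\in\mathbb{R}^d$; the edge polytope $\mathcal{P}_G$ is the convex hull of $\{\rho(e):e\in E(G)\}$. A separating hyperplane of a polytope $P$ is a hyperplane $\mathcal{H}$ meeting the relative interior of $P$ (and not containing $P$) such that $P\cap\mathcal{H}^{(+)}$ and $P\cap\mathcal{H}^{(-)}$ are integral polytopes, where for $\mathcal{H}:\sum a_ix_i=0$, $\mathcal{H}^{(+)}=\{\sum a_ix_i\ge0\}$ and $\mathcal{H}^{(-)}=\{\sum a_ix_i\le0\}$. A hyperplane $\sum_i a_ix_i=0$ is of type I if every $a_i\in\{1,-1\}$. -}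

module Defs where

open import Data.Nat using (ℕ; zero; suc)
open import Data.Fin using (Fin; zero; suc)
open import Data.Integer using (ℤ)
open import Data.Rational using (ℚ; 0ℚ; 1ℚ; _+_; _*_; _-_; -_; _≤_; _<_; _/_)
open import Data.Product using (Σ; ∃; _×_; _,_)
open import Data.Sum using (_⊎_)
open import Relation.Binary.PropositionalEquality using (_≡_; _≢_)
open import Relation.Nullary using (¬_)

Pt : ℕ → Set
Pt d = Fin d → ℚ

Region : ℕ → Set₁
Region d = Pt d → Set

Σℚ : {n : ℕ} → (Fin n → ℚ) → ℚ
Σℚ {zero}  f = 0ℚ
Σℚ {suc n} f = f zero + Σℚ (λ i → f (suc i))

lin : {d : ℕ} → Pt d → Pt d → ℚ
lin a x = Σℚ (λ i → a i * x i)

record SimpleGraph (d : ℕ) : Set₁ where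
  field
    Adj   : Fin d → Fin d → Set
    sym   : ∀ {i j} → Adj i j → Adj j i
    irrefl : ∀ {i} → ¬ Adj i i

open SimpleGraph public

data Reach {d : ℕ} (G : SimpleGraph d) : Fin d → Fin d → Set where
  here : ∀ {i} → Reach G i i
  step : ∀ {i j k} → Adj G i j → Reach G j k → Reach G i k

Connected : {d : ℕ} → SimpleGraph d → Set
Connected G = ∀ i j → Reach G i j

δ : {d : ℕ} → Fin d → Fin d → ℚ
δ zero    zero    = 1ℚ
δ zero    (suc _) = 0ℚ
δ (suc _) zero    = 0ℚ
δ (suc i) (suc j) = δ i j

ρ : {d : ℕ} → Fin d → Fin d → Pt d
ρ i j k = δ i k + δ j k

-- edge polytope P_G = conv{ρ(e) : e ∈ E(G)}: convex combinations of the ρ(i,j)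
-- with weights supported on adjacent (ordered) pairs.
EdgePolytope : {d : ℕ} → SimpleGraph d → Region d
EdgePolytope {d} G x =
  Σ (Fin d → Fin d → ℚ) λ λw →
    (∀ i j → 0ℚ ≤ λw i j) ×
    (∀ i j → λw i j ≢ 0ℚ → Adj G i j) ×
    (Σℚ (λ i → Σℚ (λ j → λw i j)) ≡ 1ℚ) ×
    (∀ k → x k ≡ Σℚ (λ i → Σℚ (λ j → λw i j * ρ i j k)))

Conv : {d : ℕ} → Region d → Region d
Conv {d} S x =
  Σ ℕ λ n → Σ (Fin n → Pt d) λ p → Σ (Fin n → ℚ) λ μ →
    (∀ t → S (p t)) ×
    (∀ t → 0ℚ ≤ μ t) ×
    (Σℚ μ ≡ 1ℚ) ×
    (∀ k → x k ≡ Σℚ (λ t → μ t * p t k))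

IsIntegerPt : {d : ℕ} → Pt d → Set
IsIntegerPt x = ∀ k → ∃ λ (z : ℤ) → x k ≡ z / 1

_∩_ : {d : ℕ} → Region d → Region d → Region d
(A ∩ B) x = A x × B x

Integral : {d : ℕ} → Region d → Set
Integral {d} Q = ∀ x → (Q x → Conv (Q ∩ IsIntegerPt) x) × (Conv (Q ∩ IsIntegerPt) x → Q x)

H⁺ H⁻ H⁰ : {d : ℕ} → Pt d → Region d
H⁺ a x = 0ℚ ≤ lin a x
H⁻ a x = lin a x ≤ 0ℚ
H⁰ a x = lin a x ≡ 0ℚ

-- relative interior of a convex set (algebraic characterization):
-- x ∈ P and every segment from a point of P through x extends a bit beyond x inside P
RelInt : {d : ℕ} → Region d → Region d
RelInt P x = P x × (∀ y → P y → Σ ℚ λ ε → (0ℚ < ε) × P (λ k → x k + ε * (x k - y k)))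

Separating : {d : ℕ} → Region d → Pt d → Set
Separating P a =
  (Σ _ λ x → RelInt P x × H⁰ a x) ×
  (¬ (∀ x → P x → H⁰ a x)) ×
  Integral (P ∩ H⁺ a) ×
  Integral (P ∩ H⁻ a)

TypeI : {d : ℕ} → Pt d → Set
TypeI a = ∀ i → (a i ≡ 1ℚ) ⊎ (a i ≡ - 1ℚ)

_≐_ : {d : ℕ} → Region d → Region d → Set
A ≐ B = ∀ x → (A x → B x) × (B x → A x)

SameDecomposition : {d : ℕ} → Region d → Pt d → Pt d → Set
SameDecomposition P a a' =
  (((P ∩ H⁺ a) ≐ (P ∩ H⁺ a')) × ((P ∩ H⁻ a) ≐ (P ∩ H⁻ a'))) ⊎
  (((P ∩ H⁺ a) ≐ (P ∩ H⁻ a')) × ((P ∩ H⁻ a) ≐ (P ∩ H⁺ a')))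

{-# OPTIONS --safe #-}
-- A type I hyperplane H : Σ aᵢxᵢ = 0 contains the vertex ρ(i,j) exactly when aᵢ + aⱼ = 0,
-- and hyperplanes giving the same decomposition cut the same section out of P_G. For
-- ±1 coefficients, knowing aᵢ and whether aᵢ + aⱼ vanishes determines aⱼ, so along a walk
-- in the connected graph a' agrees with a up to the global sign fixed at the first vertex.
module Submission where

open import Defs hiding (sym)
open import Data.Nat using (ℕ; zero; suc)
open import Data.Fin using (Fin; zero; suc)
open import Data.Rational using (ℚ; 0ℚ; 1ℚ; _+_; _*_; -_; _≤_; _≤?_)
open import Data.Rational.Properties
open import Algebra using (CommutativeMonoid)
open import Algebra.Properties.CommutativeSemigroup
  (CommutativeMonoid.commutativeSemigroup +-0-commutativeMonoid) using (interchange)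
open import Data.Product using (∃; _×_; _,_; proj₁; proj₂)
open import Data.Sign using (Sign)
open import Data.Sum using (_⊎_; inj₁; inj₂)
open import Data.Unit using (tt)
open import Function using (_⇔_; mk⇔; Equivalence)
open import Function.Properties.Equivalence using (⇔-setoid) renaming (sym to ⇔-sym)
open import Level using (0ℓ)
open import Relation.Nullary using (contradiction)
open import Relation.Nullary.Decidable using (toWitness)
open import Relation.Binary.PropositionalEquality

open Equivalence using (to; from)

Σℚ-cong : {n : ℕ} {f g : Fin n → ℚ} → (∀ k → f k ≡ g k) → Σℚ f ≡ Σℚ g
Σℚ-cong {zero}  f≗g = refl
Σℚ-cong {suc n} f≗g = cong₂ _+_ (f≗g zero) (Σℚ-cong (λ k → f≗g (suc k)))

Σℚ-+ : {n : ℕ} (f g : Fin n → ℚ) → Σℚ (λ k → f k + g k) ≡ Σℚ f + Σℚ g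
Σℚ-+ {zero}  f g = refl
Σℚ-+ {suc n} f g =
  trans (cong (f zero + g zero +_) (Σℚ-+ (λ k → f (suc k)) (λ k → g (suc k))))
        (interchange (f zero) (g zero) (Σℚ (λ k → f (suc k))) (Σℚ (λ k → g (suc k))))

*-distribˡ-Σℚ : {n : ℕ} (c : ℚ) (f : Fin n → ℚ) → c * Σℚ f ≡ Σℚ (λ k → c * f k)
*-distribˡ-Σℚ {zero}  c f = *-zeroʳ c
*-distribˡ-Σℚ {suc n} c f =
  trans (*-distribˡ-+ c (f zero) (Σℚ (λ k → f (suc k))))
        (cong (c * f zero +_) (*-distribˡ-Σℚ c (λ k → f (suc k))))

Σℚ-δ : {n : ℕ} (i : Fin n) (f : Fin n → ℚ) → Σℚ (λ k → δ i k * f k) ≡ f i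
Σℚ-δ zero    f = begin
  1ℚ * f zero + Σℚ (λ k → 0ℚ * f (suc k)) ≡⟨ cong₂ _+_ (*-identityˡ (f zero))
                                                   (sym (*-distribˡ-Σℚ 0ℚ (λ k → f (suc k)))) ⟩
  f zero + 0ℚ * Σℚ (λ k → f (suc k))      ≡⟨ cong (f zero +_) (*-zeroˡ (Σℚ (λ k → f (suc k)))) ⟩
  f zero + 0ℚ                            ≡⟨ +-identityʳ (f zero) ⟩
  f zero                                 ∎
  where open ≡-Reasoning
Σℚ-δ (suc i) f =
  trans (cong₂ _+_ (*-zeroˡ (f zero)) (Σℚ-δ i (λ k → f (suc k)))) (+-identityˡ (f (suc i)))

Σℚ²-δ : {n : ℕ} (i j : Fin n) (h : Fin n → Fin n → ℚ) →
        Σℚ (λ k → Σℚ (λ l → δ i k * δ j l * h k l)) ≡ h i j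
Σℚ²-δ i j h = begin
  Σℚ (λ k → Σℚ (λ l → δ i k * δ j l * h k l))   ≡⟨ Σℚ-cong (λ k → Σℚ-cong (λ l → *-assoc (δ i k) (δ j l) (h k l))) ⟩
  Σℚ (λ k → Σℚ (λ l → δ i k * (δ j l * h k l))) ≡⟨ Σℚ-cong (λ k → sym (*-distribˡ-Σℚ (δ i k) (λ l → δ j l * h k l))) ⟩
  Σℚ (λ k → δ i k * Σℚ (λ l → δ j l * h k l))   ≡⟨ Σℚ-δ i (λ k → Σℚ (λ l → δ j l * h k l)) ⟩
  Σℚ (λ l → δ j l * h i l)                       ≡⟨ Σℚ-δ j (h i) ⟩
  h i j                                          ∎
  where open ≡-Reasoning

lin-ρ : {n : ℕ} (a : Pt n) (i j : Fin n) → lin a (ρ i j) ≡ a i + a j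
lin-ρ a i j = begin
  Σℚ (λ k → a k * (δ i k + δ j k))          ≡⟨ Σℚ-cong (λ k → trans (*-distribˡ-+ (a k) (δ i k) (δ j k))
                                                 (cong₂ _+_ (*-comm (a k) (δ i k)) (*-comm (a k) (δ j k)))) ⟩
  Σℚ (λ k → δ i k * a k + δ j k * a k)       ≡⟨ Σℚ-+ (λ k → δ i k * a k) (λ k → δ j k * a k) ⟩
  Σℚ (λ k → δ i k * a k) + Σℚ (λ k → δ j k * a k) ≡⟨ cong₂ _+_ (Σℚ-δ i a) (Σℚ-δ j a) ⟩
  a i + a j                                  ∎
  where open ≡-Reasoning

0≤δ* : {n : ℕ} (i k : Fin n) {x : ℚ} → 0ℚ ≤ x → 0ℚ ≤ δ i k * x
0≤δ* zero    zero    {x} 0≤x = ≤-trans 0≤x (≤-reflexive (sym (*-identityˡ x)))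
0≤δ* zero    (suc k) {x} 0≤x = ≤-reflexive (sym (*-zeroˡ x))
0≤δ* (suc i) zero    {x} 0≤x = ≤-reflexive (sym (*-zeroˡ x))
0≤δ* (suc i) (suc k)     0≤x = 0≤δ* i k 0≤x

0≤δ : {n : ℕ} (i k : Fin n) → 0ℚ ≤ δ i k
0≤δ zero    zero    = toWitness {a? = 0ℚ ≤? 1ℚ} tt
0≤δ zero    (suc k) = ≤-refl
0≤δ (suc i) zero    = ≤-refl
0≤δ (suc i) (suc k) = 0≤δ i k

δ*≢0⇒≡ : {n : ℕ} (i k : Fin n) (x : ℚ) → δ i k * x ≢ 0ℚ → i ≡ k
δ*≢0⇒≡ zero    zero    x _   = refl
δ*≢0⇒≡ zero    (suc k) x ≢0 = contradiction (*-zeroˡ x) ≢0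
δ*≢0⇒≡ (suc i) zero    x ≢0 = contradiction (*-zeroˡ x) ≢0
δ*≢0⇒≡ (suc i) (suc k) x ≢0 = cong suc (δ*≢0⇒≡ i k x ≢0)

ρ∈EdgePolytope : {d : ℕ} (G : SimpleGraph d) {i j : Fin d} → Adj G i j → EdgePolytope G (ρ i j)
ρ∈EdgePolytope G {i} {j} adj =
  weight , (λ k l → 0≤δ* i k (0≤δ j l)) , support , total , coordinates
  where
  weight : Fin _ → Fin _ → ℚ
  weight k l = δ i k * δ j l

  support : ∀ k l → weight k l ≢ 0ℚ → Adj G k l
  support k l ≢0 with δ*≢0⇒≡ i k (δ j l) ≢0
                    | δ*≢0⇒≡ j l (δ i k) (λ e → ≢0 (trans (*-comm (δ i k) (δ j l)) e))
  ... | refl | refl = adj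

  total : Σℚ (λ k → Σℚ (λ l → weight k l)) ≡ 1ℚ
  total = trans (Σℚ-cong (λ k → Σℚ-cong (λ l → sym (*-identityʳ (weight k l)))))
                (Σℚ²-δ i j (λ _ _ → 1ℚ))

  coordinates : ∀ m → ρ i j m ≡ Σℚ (λ k → Σℚ (λ l → weight k l * ρ k l m))
  coordinates m = sym (Σℚ²-δ i j (λ k l → ρ k l m))

module _ {d : ℕ} (P : Region d) (a : Pt d) {x : Pt d} where

  H⁰-split : (P ∩ H⁰ a) x → (P ∩ H⁺ a) x × (P ∩ H⁻ a) x
  H⁰-split (p , h) = (p , ≤-reflexive (sym h)) , (p , ≤-reflexive h)

  H⁰-join : (P ∩ H⁺ a) x → (P ∩ H⁻ a) x → (P ∩ H⁰ a) x
  H⁰-join (p , 0≤ax) (_ , ax≤0) = p , ≤-antisym ax≤0 0≤ax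

sameDecomposition⇒sameSection : {d : ℕ} {P : Region d} {a a' : Pt d} →
  SameDecomposition P a a' → (P ∩ H⁰ a) ≐ (P ∩ H⁰ a')
sameDecomposition⇒sameSection {P = P} {a} {a'} (inj₁ (e⁺ , e⁻)) x =
  (λ q → let (q⁺ , q⁻) = H⁰-split P a q in H⁰-join P a' (proj₁ (e⁺ x) q⁺) (proj₁ (e⁻ x) q⁻)) ,
  (λ q → let (q⁺ , q⁻) = H⁰-split P a' q in H⁰-join P a (proj₂ (e⁺ x) q⁺) (proj₂ (e⁻ x) q⁻))
sameDecomposition⇒sameSection {P = P} {a} {a'} (inj₂ (e⁺ , e⁻)) x =
  (λ q → let (q⁺ , q⁻) = H⁰-split P a q in H⁰-join P a' (proj₁ (e⁻ x) q⁻) (proj₁ (e⁺ x) q⁺)) ,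
  (λ q → let (q⁺ , q⁻) = H⁰-split P a' q in H⁰-join P a (proj₂ (e⁺ x) q⁻) (proj₂ (e⁻ x) q⁺))

sameDecomposition⇒edge-sum-zero : {d : ℕ} (G : SimpleGraph d) (a a' : Pt d) →
  SameDecomposition (EdgePolytope G) a a' →
  ∀ {i j} → Adj G i j → (a i + a j ≡ 0ℚ) ⇔ (a' i + a' j ≡ 0ℚ)
sameDecomposition⇒edge-sum-zero G a a' sd {i} {j} adj = mk⇔
  (λ h → trans (sym (lin-ρ a' i j)) (proj₂ (proj₁ (section (ρ i j)) (ρ∈P , trans (lin-ρ a i j) h))))
  (λ h → trans (sym (lin-ρ a i j)) (proj₂ (proj₂ (section (ρ i j)) (ρ∈P , trans (lin-ρ a' i j) h))))
  where
  section = sameDecomposition⇒sameSection {a = a} {a'} sd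
  ρ∈P = ρ∈EdgePolytope G adj

Reach-transport : {d : ℕ} {G : SimpleGraph d} (Q : Fin d → Set) →
  (∀ {i j} → Adj G i j → Q i → Q j) → ∀ {i k} → Reach G i k → Q i → Q k
Reach-transport Q along-edge here         qi = qi
Reach-transport Q along-edge (step adj r) qi = Reach-transport Q along-edge r (along-edge adj qi)

±1 : ℚ → Set
±1 x = (x ≡ 1ℚ) ⊎ (x ≡ - 1ℚ)

signed : Sign → ℚ → ℚ
signed Sign.+ x = x
signed Sign.- x = - x

signed-+ : ∀ s x y → signed s (x + y) ≡ signed s x + signed s y
signed-+ Sign.+ x y = refl
signed-+ Sign.- x y = neg-distrib-+ x y

signed≡0⇔≡0 : ∀ s x → (signed s x ≡ 0ℚ) ⇔ (x ≡ 0ℚ)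
signed≡0⇔≡0 Sign.+ x = mk⇔ (λ h → h) (λ h → h)
signed≡0⇔≡0 Sign.- x = mk⇔ neg-injective (cong -_)

±1-signed : ∀ s {x} → ±1 x → ±1 (signed s x)
±1-signed Sign.+ x±1         = x±1
±1-signed Sign.- (inj₁ refl) = inj₂ refl
±1-signed Sign.- (inj₂ refl) = inj₁ refl

±1-sign : ∀ {x y} → ±1 x → ±1 y → ∃ λ s → y ≡ signed s x
±1-sign (inj₁ refl) (inj₁ refl) = Sign.+ , refl
±1-sign (inj₁ refl) (inj₂ refl) = Sign.- , refl
±1-sign (inj₂ refl) (inj₁ refl) = Sign.- , refl
±1-sign (inj₂ refl) (inj₂ refl) = Sign.+ , refl

±1-determined-by-sum-zero : ∀ {x y z} → ±1 x → ±1 y → ±1 z →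
  (x + y ≡ 0ℚ) ⇔ (x + z ≡ 0ℚ) → y ≡ z
±1-determined-by-sum-zero (inj₁ refl) (inj₁ refl) (inj₁ refl) _ = refl
±1-determined-by-sum-zero (inj₁ refl) (inj₁ refl) (inj₂ refl) e with from e refl
... | ()
±1-determined-by-sum-zero (inj₁ refl) (inj₂ refl) (inj₁ refl) e with to e refl
... | ()
±1-determined-by-sum-zero (inj₁ refl) (inj₂ refl) (inj₂ refl) _ = refl
±1-determined-by-sum-zero (inj₂ refl) (inj₁ refl) (inj₁ refl) _ = refl
±1-determined-by-sum-zero (inj₂ refl) (inj₁ refl) (inj₂ refl) e with to e refl
... | ()
±1-determined-by-sum-zero (inj₂ refl) (inj₂ refl) (inj₁ refl) e with from e refl
... | ()
±1-determined-by-sum-zero (inj₂ refl) (inj₂ refl) (inj₂ refl) _ = refl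

signed-edge-step : {d : ℕ} {a a' : Pt d} (s : Sign) {i j : Fin d} →
  ±1 (a j) → ±1 (a' i) → ±1 (a' j) →
  (a i + a j ≡ 0ℚ) ⇔ (a' i + a' j ≡ 0ℚ) → a' i ≡ signed s (a i) → a' j ≡ signed s (a j)
signed-edge-step {a = a} {a'} s {i} {j} aj±1 a'i±1 a'j±1 edge a'i≡ =
  ±1-determined-by-sum-zero a'i±1 a'j±1 (±1-signed s aj±1) sums
  where
  open import Relation.Binary.Reasoning.Setoid (⇔-setoid 0ℓ)
  sums : (a' i + a' j ≡ 0ℚ) ⇔ (a' i + signed s (a j) ≡ 0ℚ)
  sums = begin
    a' i + a' j ≡ 0ℚ                     ≈⟨ ⇔-sym edge ⟩
    a i + a j ≡ 0ℚ                       ≈⟨ ⇔-sym (signed≡0⇔≡0 s _) ⟩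
    signed s (a i + a j) ≡ 0ℚ            ≡⟨ cong (_≡ 0ℚ) (signed-+ s (a i) (a j)) ⟩
    signed s (a i) + signed s (a j) ≡ 0ℚ ≡⟨ cong (λ t → t + signed s (a j) ≡ 0ℚ) (sym a'i≡) ⟩
    a' i + signed s (a j) ≡ 0ℚ           ∎

sameDecomposition⇒signed : {d : ℕ} (G : SimpleGraph d) → Connected G → {a a' : Pt d} →
  TypeI a → TypeI a' → SameDecomposition (EdgePolytope G) a a' →
  ∀ s {i₀} → a' i₀ ≡ signed s (a i₀) → ∀ i → a' i ≡ signed s (a i)
sameDecomposition⇒signed G conn {a} {a'} ta ta' sd s {i₀} e₀ i =
  Reach-transport (λ k → a' k ≡ signed s (a k))
    (λ {j} {k} adj → signed-edge-step {a = a} {a'} s (ta k) (ta' j) (ta' k)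
                       (sameDecomposition⇒edge-sum-zero G a a' sd adj))
    (conn i₀ i) e₀

lemma2p2 : (d : ℕ) (G : SimpleGraph d) → Connected G →
             (a a' : Pt d) →
             TypeI a → TypeI a' →
             Separating (EdgePolytope G) a → Separating (EdgePolytope G) a' →
             SameDecomposition (EdgePolytope G) a a' →
             (∀ i → a' i ≡ a i) ⊎ (∀ i → a' i ≡ - a i)
lemma2p2 zero    G conn a a' ta ta' _ _ sd = inj₁ (λ ())
lemma2p2 (suc n) G conn a a' ta ta' _ _ sd with ±1-sign (ta zero) (ta' zero)
... | Sign.+ , e₀ = inj₁ (sameDecomposition⇒signed G conn ta ta' sd Sign.+ e₀)
... | Sign.- , e₀ = inj₂ (sameDecomposition⇒signed G conn ta ta' sd Sign.- e₀)
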